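{- Let $f\neq i$ be two classes with $P_f\ge P_i>0$, where $P_k=P(C_k)$, and for $T>0$ let $\beta_k(T)=\lceil 2P_k/T\rceil$. Let $T',T''>0$ satisfy $T'=2P_f/\beta_f(T')$ (a jump of $f$), $T''=2P_i/\beta_i(T'')$ (a jump of $i$), and $T''\le T'$. Then \[\frac{2P_i}{\beta_i(T'')+1}\le\frac{2P_f}{\beta_f(T')+1}.\]
   Context: $P(C_k)=\sum_{j\in C_k}t_j$ denotes the total processing time of the jobs of class $k$ in a scheduling instance with positive integer processing times.
   Formalization: The values $T'$ and $T''$, like the argument $T$ of $\beta_k(T)$, are taken to be positive rationals. -}

module Defs where

open import Data.Nat as ℕ using (ℕ; suc; _*_)
open import Data.Fin using (Fin)
open import Data.Fin.Properties using (_≟_)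
open import Data.List using (List; map; filter)
open import Data.Nat.ListAction using (sum)
open import Data.List.Base using (allFin)
open import Data.Integer using (ℤ; +_; ∣_∣)
open import Data.Rational using (ℚ; 0ℚ; _/_; _÷_; _>_; ceiling; positive)
open import Data.Rational.Properties using (pos⇒nonZero)

-- A scheduling instance: n jobs with processing times t j, each job j
-- belonging to class cls j among K classes.
-- P(C_k) = total processing time of the jobs of class k.
P : {n K : ℕ} → (Fin n → ℕ) → (Fin n → Fin K) → Fin K → ℕ
P {n} t cls k = sum (map t (filter (λ j → cls j ≟ k) (allFin n)))

β : ℕ → (T : ℚ) → T > 0ℚ → ℤ
β Pk T T>0 = ⌈ (((+ (2 * Pk)) / 1) ÷ T) {{pos⇒nonZero T {{positive T>0}}}} ⌉

-- The same value as a natural number (β_k(T) ≥ 0 whenever P_k ≥ 0, T > 0).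
βℕ : ℕ → (T : ℚ) → T > 0ℚ → ℕ
βℕ Pk T T>0 = ∣ β Pk T T>0 ∣

-- At the two jumps T″ ≤ T′ reads 2Pᵢ/βᵢ ≤ 2P_f/β_f, i.e. 2Pᵢ·β_f ≤ 2P_f·βᵢ after
-- cross-multiplying; adding 2Pᵢ ≤ 2P_f to both sides gives 2Pᵢ(β_f+1) ≤ 2P_f(βᵢ+1).
module Submission where

open import Defs
open import Data.Nat as ℕ using (ℕ; suc; _*_; _+_; NonZero)
import Data.Nat.Properties as ℕ
open import Data.Fin using (Fin)
open import Data.Integer using (+_)
import Data.Integer as ℤ
import Data.Integer.Properties as ℤ
open import Data.Rational using (ℚ; 0ℚ; _/_; _>_; _≤_)
open import Data.Rational.Properties using (toℚᵘ-fromℚᵘ; toℚᵘ-mono-≤; toℚᵘ-cancel-≤)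
import Data.Rational.Unnormalised as ℚᵘ
import Data.Rational.Unnormalised.Properties as ℚᵘ
open import Relation.Binary.PropositionalEquality using (_≡_; _≢_; subst₂; sym)

/-mono-cross : ∀ a b c d .{{_ : NonZero c}} .{{_ : NonZero d}} →
               a * d ℕ.≤ b * c → (+ a) / c ≤ (+ b) / d
/-mono-cross a b (suc c) (suc d) ad≤bc = toℚᵘ-cancel-≤
  (ℚᵘ.≤-respʳ-≃ (ℚᵘ.≃-sym (toℚᵘ-fromℚᵘ (ℚᵘ.mkℚᵘ (+ b) d)))
    (ℚᵘ.≤-respˡ-≃ (ℚᵘ.≃-sym (toℚᵘ-fromℚᵘ (ℚᵘ.mkℚᵘ (+ a) c)))
      (ℚᵘ.*≤* (subst₂ ℤ._≤_ (ℤ.pos-* a (suc d)) (ℤ.pos-* b (suc c)) (ℤ.+≤+ ad≤bc)))))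

/-cancel-cross : ∀ a b c d .{{_ : NonZero c}} .{{_ : NonZero d}} →
                 (+ a) / c ≤ (+ b) / d → a * d ℕ.≤ b * c
/-cancel-cross a b (suc c) (suc d) a/c≤b/d with
  ℚᵘ.≤-respˡ-≃ (toℚᵘ-fromℚᵘ (ℚᵘ.mkℚᵘ (+ a) c))
    (ℚᵘ.≤-respʳ-≃ (toℚᵘ-fromℚᵘ (ℚᵘ.mkℚᵘ (+ b) d)) (toℚᵘ-mono-≤ a/c≤b/d))
... | ℚᵘ.*≤* ad≤bc =
  ℤ.drop‿+≤+ (subst₂ ℤ._≤_ (sym (ℤ.pos-* a (suc d))) (sym (ℤ.pos-* b (suc c))) ad≤bc)

/-suc-mono : ∀ a b c d .{{_ : NonZero c}} .{{_ : NonZero d}} → a ℕ.≤ b →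
             (+ a) / c ≤ (+ b) / d → (+ a) / suc c ≤ (+ b) / suc d
/-suc-mono a b c d a≤b a/c≤b/d = /-mono-cross a b (suc c) (suc d) (begin
  a * suc d   ≡⟨ ℕ.*-suc a d ⟩
  a + a * d   ≤⟨ ℕ.+-mono-≤ a≤b (/-cancel-cross a b c d a/c≤b/d) ⟩
  b + b * c   ≡⟨ ℕ.*-suc b c ⟨
  b * suc c   ∎)
  where open ℕ.≤-Reasoning

lemma3p6 : {n K : ℕ} (t : Fin n → ℕ) → (∀ j → 0 ℕ.< t j) → (cls : Fin n → Fin K)
    → (f i : Fin K) → f ≢ i
    → P t cls i ℕ.≤ P t cls f → 0 ℕ.< P t cls i
    → (T′ T″ : ℚ) (T′>0 : T′ > 0ℚ) (T″>0 : T″ > 0ℚ)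
    → {{_ : NonZero (βℕ (P t cls f) T′ T′>0)}}
    → {{_ : NonZero (βℕ (P t cls i) T″ T″>0)}}
    → T′ ≡ (+ (2 * P t cls f)) / βℕ (P t cls f) T′ T′>0
    → T″ ≡ (+ (2 * P t cls i)) / βℕ (P t cls i) T″ T″>0
    → T″ ≤ T′
    → (+ (2 * P t cls i)) / suc (βℕ (P t cls i) T″ T″>0)
      ≤ (+ (2 * P t cls f)) / suc (βℕ (P t cls f) T′ T′>0)
lemma3p6 t _ cls f i _ Pᵢ≤Pf _ T′ T″ T′>0 T″>0 T′-jump T″-jump T″≤T′ =
  /-suc-mono (2 * P t cls i) (2 * P t cls f)
    (βℕ (P t cls i) T″ T″>0) (βℕ (P t cls f) T′ T′>0)
    (ℕ.*-monoʳ-≤ 2 Pᵢ≤Pf)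
    (subst₂ _≤_ T″-jump T′-jump T″≤T′)
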